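{- For all $w_1,w_2\in\mathfrak{h}^1$ we have $S_{w_1}S_{w_2}=S_{w_1*_-w_2}$ and $A_{w_1}A_{w_2}=A_{w_1*_+w_2}$ in $\mathcal{R}^{\mathbb{N}}$.
   Context: Let $\hbar$ be an indeterminate and $\mathcal{C}=\mathbb{Q}[\hbar]$. Let $\mathfrak{h}^1$ be the non-commutative polynomial algebra over $\mathcal{C}$ freely generated by letters $z_1,z_2,\dots$; juxtaposition is concatenation, words are monomials $z_{k_1}\cdots z_{k_r}$ ($r\ge0$, empty word $1$). Products on letters: $z_i\circ_\pm z_j=\pm z_{i+j}+\hbar z_{i+j-1}$. The $\mathcal{C}$-bilinear products $*_\pm$ on $\mathfrak{h}^1$: $1*_\pm w=w*_\pm1=w$, $(z_iw_1)*_\pm(z_jw_2)=z_i(w_1*_\pm z_jw_2)+z_j(z_iw_1*_\pm w_2)+(z_i\circ_\pm z_j)(w_1*_\pm w_2)$ for $i,j\ge1$. Let $\mathcal{R}=\mathbb{Q}[[q]]$, a $\mathcal{C}$-module with $\hbar$ acting as multiplication by $1-q$, and $\mathcal{R}^{\mathbb{N}}$ the $\mathcal{C}$-algebra of sequences $(b(n))_{n\ge0}$ in $\mathcal{R}$ with termwise product. Let $[m]=(1-q^m)/(1-q)$. For a word $u=z_{k_1}\cdots z_{k_r}$ with $r\ge1$ define $S_u(n)=\sum_{n\ge m_1\ge\dots\ge m_r\ge1}\frac{q^{m_1+\dots+m_r}}{[m_1]^{k_1}\cdots[m_r]^{k_r}}$ and $A_u(n)=\sum_{n\ge m_1>\dots>m_r>0}\frac{q^{(k_1-1)m_1+\dots+(k_r-1)m_r}}{[m_1]^{k_1}\cdots[m_r]^{k_r}}$,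 set $S_1(n)=A_1(n)=1$, and extend $u\mapsto S_u$, $u\mapsto A_u$ to $\mathcal{C}$-linear maps $\mathfrak{h}^1\to\mathcal{R}^{\mathbb{N}}$. -}

module Defs where

open import Data.Nat as ℕ using (ℕ; zero; suc; _<ᵇ_; _≡ᵇ_)
open import Data.Bool using (Bool; true; false; if_then_else_)
open import Data.List using (List; []; _∷_; map; foldr; length; upTo; zipWith; _++_; concatMap)
open import Data.Product using (_×_; _,_)
open import Data.Rational using (ℚ; 0ℚ; 1ℚ; _+_; _*_; -_)
open import Relation.Binary.PropositionalEquality using (_≡_)

-- ℛ = ℚ[[q]] : formal power series, given by their coefficient function.

Series : Set
Series = ℕ → ℚ

sumℚ : List ℚ → ℚ
sumℚ = foldr _+_ 0ℚ

Σ< : ℕ → (ℕ → ℚ) → ℚ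
Σ< n f = sumℚ (map f (upTo n))

constₛ : ℚ → Series
constₛ a zero    = a
constₛ a (suc _) = 0ℚ

0ₛ 1ₛ : Series
0ₛ = constₛ 0ℚ
1ₛ = constₛ 1ℚ

_+ₛ_ : Series → Series → Series
(f +ₛ g) k = f k + g k

-ₛ_ : Series → Series
(-ₛ f) k = - f k

_*ₛ_ : Series → Series → Series
(f *ₛ g) k = Σ< (suc k) (λ i → f i * g (k ℕ.∸ i))

infixl 6 _+ₛ_
infixl 7 _*ₛ_

powₛ : Series → ℕ → Series
powₛ f zero    = 1ₛ
powₛ f (suc n) = f *ₛ powₛ f n

qpow : ℕ → Series
qpow e k = if e ≡ᵇ k then 1ℚ else 0ℚ

qₛ : Series
qₛ = qpow 1

-- multiplicative inverse of a power series with constant term 1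
-- (g_0 = 1, g_k = - Σ_{i=1}^{k} f_i g_{k-i});
-- invRev f k = [g_k , g_{k-1} , … , g_0]
invRev : Series → ℕ → List ℚ
invNext : Series → List ℚ → ℚ
invNext f v = - sumℚ (zipWith _*_ (map (λ j → f (suc j)) (upTo (length v))) v)
invRev f zero    = 1ℚ ∷ []
invRev f (suc k) = invNext f (invRev f k) ∷ invRev f k

inv₁ : Series → Series
inv₁ f zero    = 1ℚ
inv₁ f (suc k) = invNext f (invRev f k)

-- the q-integer [m] = (1 - q^m)/(1 - q) = 1 + q + … + q^(m-1)
qint : ℕ → Series
qint m k = if k <ᵇ m then 1ℚ else 0ℚ

-- 𝒞 = ℚ[ħ] : polynomials as ascending coefficient lists

𝒞 : Set
𝒞 = List ℚ

_+𝒞_ : 𝒞 → 𝒞 → 𝒞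
[]       +𝒞 q        = q
(a ∷ p)  +𝒞 []       = a ∷ p
(a ∷ p)  +𝒞 (b ∷ q)  = (a + b) ∷ (p +𝒞 q)

_*𝒞_ : 𝒞 → 𝒞 → 𝒞
[]      *𝒞 q = []
(a ∷ p) *𝒞 q = map (a *_) q +𝒞 (0ℚ ∷ (p *𝒞 q))

ħ : 𝒞
ħ = 0ℚ ∷ 1ℚ ∷ []

-- ħ acts on ℛ as multiplication by 1 - q
ħₛ : Series
ħₛ = 1ₛ +ₛ (-ₛ qₛ)

ev𝒞 : 𝒞 → Series
ev𝒞 []      = 0ₛ
ev𝒞 (a ∷ p) = constₛ a +ₛ ħₛ *ₛ ev𝒞 p

-- 𝔥¹ : words and finite 𝒞-linear combinations of words.
-- A word z_{k₁}⋯z_{k_r} is the list [k₁ - 1 , … , k_r - 1]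
-- (entry i ∈ ℕ stands for the letter z_{i+1}, so that all indices are ≥ 1).

Word : Set
Word = List ℕ

idx : ℕ → ℕ
idx i = suc i

-- an element Σ cᵢ uᵢ of 𝔥¹ (as a formal finite sum; images are compared
-- in ℛ^ℕ, so no quotient is needed)
𝔥¹ : Set
𝔥¹ = List (𝒞 × Word)

word : Word → 𝔥¹
word u = (1ℚ ∷ [] , u) ∷ []

scale : 𝒞 → 𝔥¹ → 𝔥¹
scale c = map (λ { (d , u) → (c *𝒞 d , u) })

prefix : ℕ → 𝔥¹ → 𝔥¹
prefix i = map (λ { (d , u) → (d , i ∷ u) })

-- z_a ∘_± z_b = ± z_{a+b} + ħ z_{a+b-1}, applied as a left factor:
-- (z_a ∘± z_b) x.   With a = i+1, b = j+1: z_{a+b} ↔ i+j+1, z_{a+b-1} ↔ i+j.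
circPrefix : ℚ → ℕ → ℕ → 𝔥¹ → 𝔥¹
circPrefix σ i j x =
  scale (σ ∷ []) (prefix (suc (i ℕ.+ j)) x) ++ scale ħ (prefix (i ℕ.+ j) x)

starW : ℚ → Word → Word → 𝔥¹
starW σ []          v           = word v
starW σ u@(_ ∷ _)   []          = word u
starW σ u@(i ∷ w₁)  v@(j ∷ w₂)  =
  prefix i (starW σ w₁ v) ++ prefix j (starW σ u w₂) ++ circPrefix σ i j (starW σ w₁ w₂)

star : ℚ → 𝔥¹ → 𝔥¹ → 𝔥¹
star σ x y = concatMap (λ { (c , u) → concatMap (λ { (d , v) → scale (c *𝒞 d) (starW σ u v) }) y }) x

_*₊_ _*₋_ : 𝔥¹ → 𝔥¹ → 𝔥¹
x *₊ y = star 1ℚ x y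
x *₋ y = star (- 1ℚ) x y

Seq : Set
Seq = ℕ → Series

_·_ : Seq → Seq → Seq
(a · b) n = a n *ₛ b n

_≈ᴺ_ : Seq → Seq → Set
a ≈ᴺ b = ∀ n k → a n k ≡ b n k

-- S_u and A_u, as nested sums:
--  S_{z_k u}(n) = Σ_{m=1}^{n} q^m / [m]^k · S_u(m),          S_1 = 1
--  A_{z_k u}(n) = Σ_{m=1}^{n} q^{(k-1)m} / [m]^k · A_u(m-1),  A_1 = 1
-- which unfold to the sums over n ≥ m₁ ≥ … ≥ m_r ≥ 1, resp. n ≥ m₁ > … > m_r > 0.

sumₛ : List Series → Series
sumₛ = foldr _+ₛ_ 0ₛ

Σ₁ : ℕ → (ℕ → Series) → Series
Σ₁ n F = sumₛ (map (λ i → F (suc i)) (upTo n))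

SW : Word → Seq
SW []      n = 1ₛ
SW (i ∷ u) n = Σ₁ n (λ m → qpow m *ₛ powₛ (inv₁ (qint m)) (idx i) *ₛ SW u m)

AW : Word → Seq
AW []      n = 1ₛ
AW (i ∷ u) n = Σ₁ n (λ m → qpow ((idx i ℕ.∸ 1) ℕ.* m) *ₛ powₛ (inv₁ (qint m)) (idx i) *ₛ AW u (m ℕ.∸ 1))

S : 𝔥¹ → Seq
S x n = sumₛ (map (λ { (c , u) → ev𝒞 c *ₛ SW u n }) x)

A : 𝔥¹ → Seq
A x n = sumₛ (map (λ { (c , u) → ev𝒞 c *ₛ AW u n }) x)

module Submission where

-- Both families are iterated sums.  Writing F^S_k(m) = q^m/[m]^k and
-- F^A_k(m) = q^((k-1)m)/[m]^k, they satisfy, for every letter z_k,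
--   S_{z_k u}(n+1) = S_{z_k u}(n) + F^S_k(n+1) S_u(n+1),
--   A_{z_k u}(n+1) = A_{z_k u}(n) + F^A_k(n+1) A_u(n),
-- and vanish at n = 0.  Expanding a product of two such sums with this
-- recursion reproduces the three terms in the recursive definition of the
-- products *±, except that the "diagonal" term F_a F_b has to be rewritten as
-- F_{a+b} ± ħ F_{a+b-1}.  That diagonal identity holds for both families
-- because ħ acts as 1 - q and (1 - q)[m] = 1 - q^m.
--
-- The product formula on words is then proved once, for any
-- iterated-sum family satisfying a product expansion and a diagonal identity,
-- by induction on the pair of words and on n; S and A are instances.  The
-- theorem follows by bilinearity.

open import Defs
open import Data.Product using (_×_; _,_)
open import Data.Nat as ℕ using (ℕ; zero; suc)
import Data.Nat.Properties as ℕP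
open import Data.List using ([]; _∷_; map; upTo; applyUpTo; _++_; concatMap; length; zipWith)
open import Data.List.Properties using (map-upTo; length-applyUpTo)
open import Data.Maybe using (just; nothing)
open import Data.Rational using (ℚ; 0ℚ; 1ℚ; _+_; _*_; -_)
import Data.Rational.Base as ℚB
import Data.Rational.Properties as ℚP
open import Data.Rational.Solver using (module +-*-Solver)
open import Relation.Nullary using (yes; no)
open import Relation.Binary.Definitions using (WeaklyDecidable)
open import Relation.Binary.Structures using (IsEquivalence)
open import Relation.Binary.PropositionalEquality as P using (_≡_; refl; cong; cong₂)
import Relation.Binary.Reasoning.Setoid
open import Algebra.Solver.Ring.AlmostCommutativeRing

module QS = +-*-Solver

Σ<-applyUpTo : ∀ n F → Σ< n F ≡ sumℚ (applyUpTo F n)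
Σ<-applyUpTo n F = cong sumℚ (map-upTo F n)

Σ<-head : ∀ n F → Σ< (suc n) F ≡ F 0 + Σ< n (λ i → F (suc i))
Σ<-head n F =
  P.trans (Σ<-applyUpTo (suc n) F) (cong (F 0 +_) (P.sym (Σ<-applyUpTo n (λ i → F (suc i)))))

Σ<-cong : ∀ n {F G : ℕ → ℚ} → (∀ i → i ℕ.< n → F i ≡ G i) → Σ< n F ≡ Σ< n G
Σ<-cong zero    h = refl
Σ<-cong (suc n) {F} {G} h = begin
  Σ< (suc n) F                  ≡⟨ Σ<-head n F ⟩
  F 0 + Σ< n (λ i → F (suc i))  ≡⟨ cong₂ _+_ (h 0 (ℕ.s≤s ℕ.z≤n)) (Σ<-cong n (λ i p → h (suc i) (ℕ.s≤s p))) ⟩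
  G 0 + Σ< n (λ i → G (suc i))  ≡⟨ P.sym (Σ<-head n G) ⟩
  Σ< (suc n) G                  ∎
  where open P.≡-Reasoning

Σ<-last : ∀ n F → Σ< (suc n) F ≡ Σ< n F + F n
Σ<-last zero    F = ℚP.+-comm (F 0) 0ℚ
Σ<-last (suc n) F = begin
  Σ< (suc (suc n)) F                          ≡⟨ Σ<-head (suc n) F ⟩
  F 0 + Σ< (suc n) (λ i → F (suc i))          ≡⟨ cong (F 0 +_) (Σ<-last n (λ i → F (suc i))) ⟩
  F 0 + (Σ< n (λ i → F (suc i)) + F (suc n))  ≡⟨ P.sym (ℚP.+-assoc (F 0) _ _) ⟩
  (F 0 + Σ< n (λ i → F (suc i))) + F (suc n)  ≡⟨ cong (_+ F (suc n)) (P.sym (Σ<-head n F)) ⟩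
  Σ< (suc n) F + F (suc n)                    ∎
  where open P.≡-Reasoning

infix 4 _≈ₛ_
_≈ₛ_ : Series → Series → Set
f ≈ₛ g = ∀ k → f k ≡ g k

tl : Series → Series
tl f i = f (suc i)

_⋅_ : ℚ → Series → Series
(c ⋅ f) i = c * f i

*ₛ-head : ∀ f g k → (f *ₛ g) (suc k) ≡ f 0 * g (suc k) + (tl f *ₛ g) k
*ₛ-head f g k = Σ<-head (suc k) (λ i → f i * g (suc k ℕ.∸ i))

*ₛ-last : ∀ f g k → (f *ₛ g) (suc k) ≡ (f *ₛ tl g) k + f (suc k) * g 0
*ₛ-last f g k = P.trans (Σ<-last (suc k) (λ i → f i * g (suc k ℕ.∸ i)))
  (cong₂ _+_ (Σ<-cong (suc k) (λ i p → cong (λ t → f i * g t) (ℕP.+-∸-assoc 1 (ℕP.≤-pred p))))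
             (cong (λ t → f (suc k) * g t) (ℕP.n∸n≡0 k)))

*ₛ-comm : ∀ f g → f *ₛ g ≈ₛ g *ₛ f
*ₛ-comm f g zero    = cong (_+ 0ℚ) (ℚP.*-comm (f 0) (g 0))
*ₛ-comm f g (suc k) = begin
  (f *ₛ g) (suc k)                    ≡⟨ *ₛ-head f g k ⟩
  f 0 * g (suc k) + (tl f *ₛ g) k     ≡⟨ cong₂ _+_ (ℚP.*-comm (f 0) (g (suc k))) (*ₛ-comm (tl f) g k) ⟩
  g (suc k) * f 0 + (g *ₛ tl f) k     ≡⟨ ℚP.+-comm (g (suc k) * f 0) _ ⟩
  (g *ₛ tl f) k + g (suc k) * f 0     ≡⟨ P.sym (*ₛ-last g f k) ⟩
  (g *ₛ f) (suc k)                    ∎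
  where open P.≡-Reasoning

*ₛ-cong : ∀ {f f′ g g′} → f ≈ₛ f′ → g ≈ₛ g′ → f *ₛ g ≈ₛ f′ *ₛ g′
*ₛ-cong p q k = Σ<-cong (suc k) (λ i _ → cong₂ _*_ (p i) (q (k ℕ.∸ i)))

*ₛ-zeroˡ : ∀ f g → (∀ i → f i ≡ 0ℚ) → ∀ k → (f *ₛ g) k ≡ 0ℚ
*ₛ-zeroˡ f g f≈0 zero    rewrite f≈0 0 = P.trans (ℚP.+-identityʳ _) (ℚP.*-zeroˡ (g 0))
*ₛ-zeroˡ f g f≈0 (suc k)
  rewrite *ₛ-head f g k | f≈0 0 | *ₛ-zeroˡ (tl f) g (λ i → f≈0 (suc i)) k
  = P.trans (ℚP.+-identityʳ _) (ℚP.*-zeroˡ (g (suc k)))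

*ₛ-distribʳ : ∀ f g h → (f +ₛ g) *ₛ h ≈ₛ f *ₛ h +ₛ g *ₛ h
*ₛ-distribʳ f g h zero = QS.solve 3 (λ a b c →
  (a QS.:+ b) QS.:* c QS.:+ QS.con 0ℚ QS.:= (a QS.:* c QS.:+ QS.con 0ℚ) QS.:+ (b QS.:* c QS.:+ QS.con 0ℚ))
  refl (f 0) (g 0) (h 0)
*ₛ-distribʳ f g h (suc k) = begin
  ((f +ₛ g) *ₛ h) (suc k)
    ≡⟨ *ₛ-head (f +ₛ g) h k ⟩
  (f 0 + g 0) * h (suc k) + ((tl f +ₛ tl g) *ₛ h) k
    ≡⟨ cong ((f 0 + g 0) * h (suc k) +_) (*ₛ-distribʳ (tl f) (tl g) h k) ⟩
  (f 0 + g 0) * h (suc k) + ((tl f *ₛ h) k + (tl g *ₛ h) k)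
    ≡⟨ QS.solve 5 (λ a b c x y → (a QS.:+ b) QS.:* c QS.:+ (x QS.:+ y)
                                 QS.:= (a QS.:* c QS.:+ x) QS.:+ (b QS.:* c QS.:+ y))
                  refl (f 0) (g 0) (h (suc k)) _ _ ⟩
  (f 0 * h (suc k) + (tl f *ₛ h) k) + (g 0 * h (suc k) + (tl g *ₛ h) k)
    ≡⟨ P.sym (cong₂ _+_ (*ₛ-head f h k) (*ₛ-head g h k)) ⟩
  (f *ₛ h +ₛ g *ₛ h) (suc k) ∎
  where open P.≡-Reasoning

*ₛ-scaleˡ : ∀ c f h → (c ⋅ f) *ₛ h ≈ₛ c ⋅ (f *ₛ h)
*ₛ-scaleˡ c f h zero = QS.solve 3 (λ c a b →
  c QS.:* a QS.:* b QS.:+ QS.con 0ℚ QS.:= c QS.:* (a QS.:* b QS.:+ QS.con 0ℚ)) refl c (f 0) (h 0)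
*ₛ-scaleˡ c f h (suc k) = begin
  ((c ⋅ f) *ₛ h) (suc k)                    ≡⟨ *ₛ-head (c ⋅ f) h k ⟩
  c * f 0 * h (suc k) + ((c ⋅ tl f) *ₛ h) k ≡⟨ cong (c * f 0 * h (suc k) +_) (*ₛ-scaleˡ c (tl f) h k) ⟩
  c * f 0 * h (suc k) + c * (tl f *ₛ h) k
    ≡⟨ QS.solve 4 (λ c a b x → c QS.:* a QS.:* b QS.:+ c QS.:* x QS.:= c QS.:* (a QS.:* b QS.:+ x))
                  refl c (f 0) (h (suc k)) _ ⟩
  c * (f 0 * h (suc k) + (tl f *ₛ h) k)     ≡⟨ cong (c *_) (P.sym (*ₛ-head f h k)) ⟩
  c * (f *ₛ h) (suc k)                      ∎
  where open P.≡-Reasoning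

*ₛ-constˡ : ∀ c h → constₛ c *ₛ h ≈ₛ c ⋅ h
*ₛ-constˡ c h zero    = ℚP.+-identityʳ (c * h 0)
*ₛ-constˡ c h (suc k)
  rewrite *ₛ-head (constₛ c) h k | *ₛ-zeroˡ (tl (constₛ c)) h (λ _ → refl) k
  = ℚP.+-identityʳ (c * h (suc k))

*ₛ-assoc : ∀ f g h → (f *ₛ g) *ₛ h ≈ₛ f *ₛ (g *ₛ h)
*ₛ-assoc f g h zero = QS.solve 3 (λ a b c →
  (a QS.:* b QS.:+ QS.con 0ℚ) QS.:* c QS.:+ QS.con 0ℚ
  QS.:= a QS.:* (b QS.:* c QS.:+ QS.con 0ℚ) QS.:+ QS.con 0ℚ) refl (f 0) (g 0) (h 0)
*ₛ-assoc f g h (suc k) = begin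
  ((f *ₛ g) *ₛ h) (suc k)
    ≡⟨ *ₛ-head (f *ₛ g) h k ⟩
  fg₀ * h (suc k) + (tl (f *ₛ g) *ₛ h) k
    ≡⟨ cong (fg₀ * h (suc k) +_) (*ₛ-cong {g = h} (*ₛ-head f g) (λ _ → refl) k) ⟩
  fg₀ * h (suc k) + ((f 0 ⋅ tl g +ₛ tl f *ₛ g) *ₛ h) k
    ≡⟨ cong (fg₀ * h (suc k) +_) (*ₛ-distribʳ (f 0 ⋅ tl g) (tl f *ₛ g) h k) ⟩
  fg₀ * h (suc k) + (((f 0 ⋅ tl g) *ₛ h) k + ((tl f *ₛ g) *ₛ h) k)
    ≡⟨ cong (fg₀ * h (suc k) +_) (cong₂ _+_ (*ₛ-scaleˡ (f 0) (tl g) h k) (*ₛ-assoc (tl f) g h k)) ⟩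
  fg₀ * h (suc k) + (f 0 * (tl g *ₛ h) k + (tl f *ₛ (g *ₛ h)) k)
    ≡⟨ QS.solve 5 (λ a b c x y → (a QS.:* b QS.:+ QS.con 0ℚ) QS.:* c QS.:+ (a QS.:* x QS.:+ y)
                                 QS.:= a QS.:* (b QS.:* c QS.:+ x) QS.:+ y)
                  refl (f 0) (g 0) (h (suc k)) _ _ ⟩
  f 0 * (g 0 * h (suc k) + (tl g *ₛ h) k) + (tl f *ₛ (g *ₛ h)) k
    ≡⟨ cong (λ t → f 0 * t + (tl f *ₛ (g *ₛ h)) k) (P.sym (*ₛ-head g h k)) ⟩
  f 0 * (g *ₛ h) (suc k) + (tl f *ₛ (g *ₛ h)) k
    ≡⟨ P.sym (*ₛ-head f (g *ₛ h) k) ⟩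
  (f *ₛ (g *ₛ h)) (suc k) ∎
  where
  open P.≡-Reasoning
  fg₀ = (f *ₛ g) 0

*ₛ-identityˡ : ∀ f → 1ₛ *ₛ f ≈ₛ f
*ₛ-identityˡ f k = P.trans (*ₛ-constˡ 1ℚ f k) (ℚP.*-identityˡ (f k))

*ₛ-neg : ∀ f g → (-ₛ f) *ₛ g ≈ₛ -ₛ (f *ₛ g)
*ₛ-neg f g k = begin
  ((-ₛ f) *ₛ g) k          ≡⟨ *ₛ-cong {g = g} (λ i → P.sym (neg-as-scale (f i))) (λ _ → refl) k ⟩
  (((- 1ℚ) ⋅ f) *ₛ g) k    ≡⟨ *ₛ-scaleˡ (- 1ℚ) f g k ⟩
  - 1ℚ * (f *ₛ g) k        ≡⟨ neg-as-scale _ ⟩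
  - (f *ₛ g) k             ∎
  where
  open P.≡-Reasoning
  neg-as-scale : ∀ x → - 1ℚ * x ≡ - x
  neg-as-scale = QS.solve 1 (λ x → QS.con (- 1ℚ) QS.:* x QS.:= QS.:- x) refl

-- ℚ[[q]] as a commutative ring.  Equality is wrapped in a record so that the
-- ring solver's setoid is not a function type (which Agda would η-expand,
-- losing the series being compared).

infix 4 _≋_
record _≋_ (f g : Series) : Set where
  constructor ⟨_⟩
  field at : f ≈ₛ g
open _≋_

≋-isEquivalence : IsEquivalence _≋_
≋-isEquivalence = record
  { refl  = ⟨ (λ _ → refl) ⟩
  ; sym   = λ p → ⟨ (λ k → P.sym (at p k)) ⟩
  ; trans = λ p q → ⟨ (λ k → P.trans (at p k) (at q k)) ⟩
  }

0ₛ-coeff : ∀ k → 0ₛ k ≡ 0ℚ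
0ₛ-coeff zero    = refl
0ₛ-coeff (suc k) = refl

module _ where
  open import Algebra.Structures _≋_
  open import Algebra.Structures.Biased _≋_

  +ₛ-isCommutativeMonoid : IsCommutativeMonoid _+ₛ_ 0ₛ
  +ₛ-isCommutativeMonoid = IsCommutativeMonoidˡ.isCommutativeMonoid (record
    { isSemigroup = record
      { isMagma = record
        { isEquivalence = ≋-isEquivalence
        ; ∙-cong = λ p q → ⟨ (λ k → cong₂ _+_ (at p k) (at q k)) ⟩ }
      ; assoc = λ f g h → ⟨ (λ k → ℚP.+-assoc (f k) (g k) (h k)) ⟩ }
    ; identityˡ = λ f → ⟨ (λ k → P.trans (cong (_+ f k) (0ₛ-coeff k)) (ℚP.+-identityˡ (f k))) ⟩
    ; comm = λ f g → ⟨ (λ k → ℚP.+-comm (f k) (g k)) ⟩ })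

  *ₛ-isCommutativeMonoid : IsCommutativeMonoid _*ₛ_ 1ₛ
  *ₛ-isCommutativeMonoid = IsCommutativeMonoidˡ.isCommutativeMonoid (record
    { isSemigroup = record
      { isMagma = record
        { isEquivalence = ≋-isEquivalence
        ; ∙-cong = λ p q → ⟨ *ₛ-cong (at p) (at q) ⟩ }
      ; assoc = λ f g h → ⟨ *ₛ-assoc f g h ⟩ }
    ; identityˡ = λ f → ⟨ *ₛ-identityˡ f ⟩
    ; comm = λ f g → ⟨ *ₛ-comm f g ⟩ })

  seriesRing : AlmostCommutativeRing _ _
  seriesRing = record
    { Carrier = Series ; _≈_ = _≋_ ; _+_ = _+ₛ_ ; _*_ = _*ₛ_ ; -_ = -ₛ_ ; 0# = 0ₛ ; 1# = 1ₛ
    ; isAlmostCommutativeRing = record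
      { isCommutativeSemiring = IsCommutativeSemiringˡ.isCommutativeSemiring (record
          { +-isCommutativeMonoid = +ₛ-isCommutativeMonoid
          ; *-isCommutativeMonoid = *ₛ-isCommutativeMonoid
          ; distribʳ = λ h f g → ⟨ *ₛ-distribʳ f g h ⟩
          ; zeroˡ = λ f → ⟨ (λ k → P.trans (*ₛ-zeroˡ 0ₛ f 0ₛ-coeff k) (P.sym (0ₛ-coeff k))) ⟩ })
      ; -‿cong = λ p → ⟨ (λ k → cong -_ (at p k)) ⟩
      ; -‿*-distribˡ = λ f g → ⟨ *ₛ-neg f g ⟩
      ; -‿+-comm = λ f g → ⟨ (λ k → P.sym (QS.solve 2 (λ x y →
                     QS.:- (x QS.:+ y) QS.:= (QS.:- x) QS.:+ (QS.:- y)) refl (f k) (g k))) ⟩ } }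

const-+ : ∀ a b → constₛ (a + b) ≋ constₛ a +ₛ constₛ b
const-+ a b = ⟨ (λ { zero → refl ; (suc k) → P.sym (ℚP.+-identityʳ 0ℚ) }) ⟩

const-* : ∀ a b → constₛ (a * b) ≈ₛ constₛ a *ₛ constₛ b
const-* a b k = P.sym (P.trans (*ₛ-constˡ a (constₛ b) k) (scale-const k))
  where
  scale-const : ∀ k → a * constₛ b k ≡ constₛ (a * b) k
  scale-const zero    = refl
  scale-const (suc k) = ℚP.*-zeroʳ a

constMorphism : ℚB.+-*-rawRing -Raw-AlmostCommutative⟶ seriesRing
constMorphism = record
  { ⟦_⟧    = constₛ
  ; +-homo = const-+
  ; *-homo = λ a b → ⟨ const-* a b ⟩
  ; -‿homo = λ a → ⟨ (λ { zero → refl ; (suc k) → refl }) ⟩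
  ; 0-homo = ⟨ (λ { zero → refl ; (suc k) → refl }) ⟩
  ; 1-homo = ⟨ (λ { zero → refl ; (suc k) → refl }) ⟩ }

coefficient? : WeaklyDecidable (Induced-equivalence constMorphism)
coefficient? a b with a ℚP.≟ b
... | yes refl = just ⟨ (λ _ → refl) ⟩
... | no _     = nothing

open import Algebra.Solver.Ring ℚB.+-*-rawRing seriesRing constMorphism coefficient?
open AlmostCommutativeRing seriesRing
  using (setoid; +-cong; *-cong; -‿cong; reflexive)
  renaming (refl to ≋-refl; sym to ≋-sym; trans to ≋-trans)
module ≋-Reasoning = Relation.Binary.Reasoning.Setoid setoid

-- One-sided congruences.  The fixed operand is explicit: it cannot be
-- inferred by unification, because a product or sum of series unfolds.
*-congˡ : ∀ x {a b} → a ≋ b → x *ₛ a ≋ x *ₛ b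
*-congˡ x p = *-cong (≋-refl {x}) p

*-congʳ : ∀ x {a b} → a ≋ b → a *ₛ x ≋ b *ₛ x
*-congʳ x p = *-cong p (≋-refl {x})

+-congˡ : ∀ x {a b} → a ≋ b → x +ₛ a ≋ x +ₛ b
+-congˡ x p = +-cong (≋-refl {x}) p

+-congʳ : ∀ x {a b} → a ≋ b → a +ₛ x ≋ b +ₛ x
+-congʳ x p = +-cong p (≋-refl {x})

qpow-zero : qpow 0 ≈ₛ 1ₛ
qpow-zero zero    = refl
qpow-zero (suc k) = refl

qpow-zero-* : ∀ g → qpow 0 *ₛ g ≈ₛ g
qpow-zero-* g k = P.trans (*ₛ-cong {g = g} qpow-zero (λ _ → refl) k) (*ₛ-identityˡ g k)

qpow-shift-head : ∀ a g → (qpow (suc a) *ₛ g) 0 ≡ 0ℚ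
qpow-shift-head a g = P.trans (ℚP.+-identityʳ _) (ℚP.*-zeroˡ (g 0))

qpow-shift : ∀ a g k → (qpow (suc a) *ₛ g) (suc k) ≡ (qpow a *ₛ g) k
qpow-shift a g k = P.trans (*ₛ-head (qpow (suc a)) g k)
  (P.trans (cong (_+ (qpow a *ₛ g) k) (ℚP.*-zeroˡ (g (suc k)))) (ℚP.+-identityˡ _))

qpow-+ : ∀ a b → qpow a *ₛ qpow b ≈ₛ qpow (a ℕ.+ b)
qpow-+ zero    b         = qpow-zero-* (qpow b)
qpow-+ (suc a) b zero    = qpow-shift-head a (qpow b)
qpow-+ (suc a) b (suc k) = P.trans (qpow-shift a (qpow b) k) (qpow-+ a b k)

qint-zero : qint 0 ≋ 0ₛ
qint-zero = ⟨ (λ { zero → refl ; (suc k) → refl }) ⟩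

qint-suc : ∀ m → qint (suc m) ≋ 1ₛ +ₛ qₛ *ₛ qint m
qint-suc m = ⟨ coeff ⟩
  where
  coeff : ∀ k → qint (suc m) k ≡ (1ₛ +ₛ qₛ *ₛ qint m) k
  coeff zero    = P.sym (cong (1ℚ +_) (qpow-shift-head 0 (qint m)))
  coeff (suc k) = P.sym (P.trans (cong (0ℚ +_) (P.trans (qpow-shift 0 (qint m) k) (qpow-zero-* (qint m) k)))
                                 (ℚP.+-identityˡ _))

ħ-qint : ∀ m → ħₛ *ₛ qint m ≋ 1ₛ +ₛ -ₛ qpow m
ħ-qint zero = begin
  ħₛ *ₛ qint 0       ≈⟨ *-congˡ ħₛ qint-zero ⟩
  ħₛ *ₛ 0ₛ           ≈⟨ solve 1 (λ h → h :* con 0ℚ := con 1ℚ :+ :- con 1ℚ) ≋-refl ħₛ ⟩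
  1ₛ +ₛ -ₛ 1ₛ        ≈⟨ +-congˡ 1ₛ (-‿cong (≋-sym ⟨ qpow-zero ⟩)) ⟩
  1ₛ +ₛ -ₛ qpow 0    ∎
  where open ≋-Reasoning
ħ-qint (suc m) = begin
  ħₛ *ₛ qint (suc m)                         ≈⟨ *-congˡ ħₛ (qint-suc m) ⟩
  ħₛ *ₛ (1ₛ +ₛ qₛ *ₛ qint m)
    ≈⟨ solve 2 (λ q x → (con 1ℚ :+ :- q) :* (con 1ℚ :+ q :* x)
                        := con 1ℚ :+ :- q :+ q :* ((con 1ℚ :+ :- q) :* x)) ≋-refl qₛ (qint m) ⟩
  1ₛ +ₛ -ₛ qₛ +ₛ qₛ *ₛ (ħₛ *ₛ qint m)        ≈⟨ +-congˡ (1ₛ +ₛ -ₛ qₛ) (*-congˡ qₛ (ħ-qint m)) ⟩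
  1ₛ +ₛ -ₛ qₛ +ₛ qₛ *ₛ (1ₛ +ₛ -ₛ qpow m)
    ≈⟨ solve 2 (λ q x → con 1ℚ :+ :- q :+ q :* (con 1ℚ :+ :- x) := con 1ℚ :+ :- (q :* x))
               ≋-refl qₛ (qpow m) ⟩
  1ₛ +ₛ -ₛ (qₛ *ₛ qpow m)                   ≈⟨ +-congˡ 1ₛ (-‿cong ⟨ qpow-+ 1 m ⟩) ⟩
  1ₛ +ₛ -ₛ qpow (suc m)                     ∎
  where open ≋-Reasoning

invRev-applyUpTo : ∀ f k → invRev f k ≡ applyUpTo (λ j → inv₁ f (k ℕ.∸ j)) (suc k)
invRev-applyUpTo f zero    = refl
invRev-applyUpTo f (suc k) = cong (inv₁ f (suc k) ∷_) (invRev-applyUpTo f k)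

zipWith-applyUpTo : ∀ (a b : ℕ → ℚ) n →
  zipWith _*_ (applyUpTo a n) (applyUpTo b n) ≡ applyUpTo (λ j → a j * b j) n
zipWith-applyUpTo a b zero    = refl
zipWith-applyUpTo a b (suc n) =
  cong (a 0 * b 0 ∷_) (zipWith-applyUpTo (λ j → a (suc j)) (λ j → b (suc j)) n)

inv₁-suc : ∀ f k → inv₁ f (suc k) ≡ - (tl f *ₛ inv₁ f) k
inv₁-suc f k = begin
  invNext f (invRev f k)
    ≡⟨ cong (invNext f) (invRev-applyUpTo f k) ⟩
  - sumℚ (zipWith _*_ (map (tl f) (upTo (length G))) G)
    ≡⟨ cong (λ n → - sumℚ (zipWith _*_ (map (tl f) (upTo n)) G)) (length-applyUpTo g (suc k)) ⟩
  - sumℚ (zipWith _*_ (map (tl f) (upTo (suc k))) G)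
    ≡⟨ cong (λ F → - sumℚ (zipWith _*_ F G)) (map-upTo (tl f) (suc k)) ⟩
  - sumℚ (zipWith _*_ (applyUpTo (tl f) (suc k)) G)
    ≡⟨ cong (λ v → - sumℚ v) (zipWith-applyUpTo (tl f) g (suc k)) ⟩
  - sumℚ (applyUpTo (λ j → tl f j * g j) (suc k))
    ≡⟨ cong -_ (P.sym (Σ<-applyUpTo (suc k) (λ j → tl f j * g j))) ⟩
  - (tl f *ₛ inv₁ f) k ∎
  where
  open P.≡-Reasoning
  g : ℕ → ℚ
  g j = inv₁ f (k ℕ.∸ j)
  G = applyUpTo g (suc k)

inv₁-inverse : ∀ f → f 0 ≡ 1ℚ → f *ₛ inv₁ f ≋ 1ₛ
inv₁-inverse f f₀≡1 = ⟨ coeff ⟩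
  where
  coeff : ∀ k → (f *ₛ inv₁ f) k ≡ 1ₛ k
  coeff zero    = cong (λ t → t * 1ℚ + 0ℚ) f₀≡1
  coeff (suc k) = P.trans (*ₛ-head f (inv₁ f) k)
    (P.trans (cong₂ (λ a b → a * b + (tl f *ₛ inv₁ f) k) f₀≡1 (inv₁-suc f k))
             (QS.solve 1 (λ x → QS.con 1ℚ QS.:* (QS.:- x) QS.:+ x QS.:= QS.con 0ℚ) refl ((tl f *ₛ inv₁ f) k)))

Inv : ℕ → Series
Inv m = inv₁ (qint m)

qint-Inv : ∀ m → qint (suc m) *ₛ Inv (suc m) ≋ 1ₛ
qint-Inv m = inv₁-inverse (qint (suc m)) refl

pow-+ : ∀ x a b → powₛ x (a ℕ.+ b) ≋ powₛ x a *ₛ powₛ x b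
pow-+ x zero    b = ≋-sym ⟨ *ₛ-identityˡ (powₛ x b) ⟩
pow-+ x (suc a) b = begin
  x *ₛ powₛ x (a ℕ.+ b)          ≈⟨ *-congˡ x (pow-+ x a b) ⟩
  x *ₛ (powₛ x a *ₛ powₛ x b)    ≈⟨ ≋-sym ⟨ *ₛ-assoc x (powₛ x a) (powₛ x b) ⟩ ⟩
  x *ₛ powₛ x a *ₛ powₛ x b      ∎
  where open ≋-Reasoning

ev-+ : ∀ p q → ev𝒞 (p +𝒞 q) ≋ ev𝒞 p +ₛ ev𝒞 q
ev-+ []      q       = solve 1 (λ x → x := con 0ℚ :+ x) ≋-refl (ev𝒞 q)
ev-+ (a ∷ p) []      = solve 1 (λ x → x := x :+ con 0ℚ) ≋-refl (ev𝒞 (a ∷ p))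
ev-+ (a ∷ p) (b ∷ q) = begin
  constₛ (a + b) +ₛ ħₛ *ₛ ev𝒞 (p +𝒞 q)               ≈⟨ +-cong (const-+ a b) (*-congˡ ħₛ (ev-+ p q)) ⟩
  (constₛ a +ₛ constₛ b) +ₛ ħₛ *ₛ (ev𝒞 p +ₛ ev𝒞 q)
    ≈⟨ solve 5 (λ a b h x y → (a :+ b) :+ h :* (x :+ y) := (a :+ h :* x) :+ (b :+ h :* y))
               ≋-refl (constₛ a) (constₛ b) ħₛ (ev𝒞 p) (ev𝒞 q) ⟩
  ev𝒞 (a ∷ p) +ₛ ev𝒞 (b ∷ q)                         ∎
  where open ≋-Reasoning

ev-scale : ∀ a q → ev𝒞 (map (a *_) q) ≋ constₛ a *ₛ ev𝒞 q
ev-scale a []      = solve 1 (λ x → con 0ℚ := x :* con 0ℚ) ≋-refl (constₛ a)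
ev-scale a (b ∷ q) = begin
  constₛ (a * b) +ₛ ħₛ *ₛ ev𝒞 (map (a *_) q)            ≈⟨ +-cong ⟨ const-* a b ⟩ (*-congˡ ħₛ (ev-scale a q)) ⟩
  constₛ a *ₛ constₛ b +ₛ ħₛ *ₛ (constₛ a *ₛ ev𝒞 q)
    ≈⟨ solve 4 (λ a b h x → (a :* b) :+ h :* (a :* x) := a :* (b :+ h :* x))
               ≋-refl (constₛ a) (constₛ b) ħₛ (ev𝒞 q) ⟩
  constₛ a *ₛ ev𝒞 (b ∷ q)                               ∎
  where open ≋-Reasoning

ev-* : ∀ p q → ev𝒞 (p *𝒞 q) ≋ ev𝒞 p *ₛ ev𝒞 q
ev-* []      q = solve 1 (λ x → con 0ℚ := con 0ℚ :* x) ≋-refl (ev𝒞 q)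
ev-* (a ∷ p) q = begin
  ev𝒞 (map (a *_) q +𝒞 (0ℚ ∷ (p *𝒞 q)))
    ≈⟨ ev-+ (map (a *_) q) (0ℚ ∷ (p *𝒞 q)) ⟩
  ev𝒞 (map (a *_) q) +ₛ (constₛ 0ℚ +ₛ ħₛ *ₛ ev𝒞 (p *𝒞 q))
    ≈⟨ +-cong (ev-scale a q) (+-congˡ (constₛ 0ℚ) (*-congˡ ħₛ (ev-* p q))) ⟩
  constₛ a *ₛ ev𝒞 q +ₛ (constₛ 0ℚ +ₛ ħₛ *ₛ (ev𝒞 p *ₛ ev𝒞 q))
    ≈⟨ solve 4 (λ a h x y → a :* y :+ (con 0ℚ :+ h :* (x :* y)) := (a :+ h :* x) :* y)
               ≋-refl (constₛ a) ħₛ (ev𝒞 p) (ev𝒞 q) ⟩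
  ev𝒞 (a ∷ p) *ₛ ev𝒞 q ∎
  where open ≋-Reasoning

ev-const : ∀ a → ev𝒞 (a ∷ []) ≋ constₛ a
ev-const a = solve 2 (λ a h → a :+ h :* con 0ℚ := a) ≋-refl (constₛ a) ħₛ

ev-ħ : ev𝒞 ħ ≋ ħₛ
ev-ħ = solve 1 (λ h → con 0ℚ :+ h :* (con 1ℚ :+ h :* con 0ℚ) := h) ≋-refl ħₛ

L : (Word → Seq) → 𝔥¹ → Seq
L W []              n = 0ₛ
L W ((c , u) ∷ x) n = ev𝒞 c *ₛ W u n +ₛ L W x n

S-is-L : ∀ x n → S x n ≡ L SW x n
S-is-L []            n = refl
S-is-L ((c , u) ∷ x) n = cong (ev𝒞 c *ₛ SW u n +ₛ_) (S-is-L x n)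

A-is-L : ∀ x n → A x n ≡ L AW x n
A-is-L []            n = refl
A-is-L ((c , u) ∷ x) n = cong (ev𝒞 c *ₛ AW u n +ₛ_) (A-is-L x n)

module Linear (W : Word → Seq) where

  L-++ : ∀ x y n → L W (x ++ y) n ≋ L W x n +ₛ L W y n
  L-++ []            y n = solve 1 (λ a → a := con 0ℚ :+ a) ≋-refl (L W y n)
  L-++ ((c , u) ∷ x) y n = begin
    ev𝒞 c *ₛ W u n +ₛ L W (x ++ y) n            ≈⟨ +-congˡ (ev𝒞 c *ₛ W u n) (L-++ x y n) ⟩
    ev𝒞 c *ₛ W u n +ₛ (L W x n +ₛ L W y n)
      ≈⟨ solve 3 (λ a b d → a :+ (b :+ d) := (a :+ b) :+ d) ≋-refl (ev𝒞 c *ₛ W u n) (L W x n) (L W y n) ⟩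
    (ev𝒞 c *ₛ W u n +ₛ L W x n) +ₛ L W y n      ∎
    where open ≋-Reasoning

  L-scale : ∀ c x n → L W (scale c x) n ≋ ev𝒞 c *ₛ L W x n
  L-scale c []            n = solve 1 (λ a → con 0ℚ := a :* con 0ℚ) ≋-refl (ev𝒞 c)
  L-scale c ((d , u) ∷ x) n = begin
    ev𝒞 (c *𝒞 d) *ₛ W u n +ₛ L W (scale c x) n    ≈⟨ +-cong (*-congʳ (W u n) (ev-* c d)) (L-scale c x n) ⟩
    (ev𝒞 c *ₛ ev𝒞 d) *ₛ W u n +ₛ ev𝒞 c *ₛ L W x n
      ≈⟨ solve 4 (λ a b w l → (a :* b) :* w :+ a :* l := a :* (b :* w :+ l))
                 ≋-refl (ev𝒞 c) (ev𝒞 d) (W u n) (L W x n) ⟩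
    ev𝒞 c *ₛ (ev𝒞 d *ₛ W u n +ₛ L W x n)          ∎
    where open ≋-Reasoning

  L-word : ∀ u n → L W (word u) n ≋ W u n
  L-word u n = begin
    ev𝒞 (1ℚ ∷ []) *ₛ W u n +ₛ 0ₛ   ≈⟨ +-congʳ 0ₛ (*-congʳ (W u n) (ev-const 1ℚ)) ⟩
    constₛ 1ℚ *ₛ W u n +ₛ 0ₛ       ≈⟨ solve 1 (λ a → con 1ℚ :* a :+ con 0ℚ := a) ≋-refl (W u n) ⟩
    W u n                          ∎
    where open ≋-Reasoning

  L-starW : ∀ σ i j w₁ w₂ n → L W (starW σ (i ∷ w₁) (j ∷ w₂)) n ≋
    L W (prefix i (starW σ w₁ (j ∷ w₂))) n +ₛ (L W (prefix j (starW σ (i ∷ w₁) w₂)) n +ₛ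
      (constₛ σ *ₛ L W (prefix (suc (i ℕ.+ j)) (starW σ w₁ w₂)) n +ₛ
       ħₛ *ₛ L W (prefix (i ℕ.+ j) (starW σ w₁ w₂)) n))
  L-starW σ i j w₁ w₂ n = begin
    L W (Pi ++ (Pj ++ (scale (σ ∷ []) Pd ++ scale ħ Pd′))) n
      ≈⟨ L-++ Pi _ n ⟩
    L W Pi n +ₛ L W (Pj ++ (scale (σ ∷ []) Pd ++ scale ħ Pd′)) n
      ≈⟨ +-congˡ (L W Pi n) (L-++ Pj _ n) ⟩
    L W Pi n +ₛ (L W Pj n +ₛ L W (scale (σ ∷ []) Pd ++ scale ħ Pd′) n)
      ≈⟨ +-congˡ (L W Pi n) (+-congˡ (L W Pj n) (L-++ (scale (σ ∷ []) Pd) _ n)) ⟩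
    L W Pi n +ₛ (L W Pj n +ₛ (L W (scale (σ ∷ []) Pd) n +ₛ L W (scale ħ Pd′) n))
      ≈⟨ +-congˡ (L W Pi n) (+-congˡ (L W Pj n) (+-cong
           (≋-trans (L-scale (σ ∷ []) Pd n) (*-congʳ (L W Pd n) (ev-const σ)))
           (≋-trans (L-scale ħ Pd′ n) (*-congʳ (L W Pd′ n) ev-ħ)))) ⟩
    L W Pi n +ₛ (L W Pj n +ₛ (constₛ σ *ₛ L W Pd n +ₛ ħₛ *ₛ L W Pd′ n)) ∎
    where
    open ≋-Reasoning
    Pi  = prefix i (starW σ w₁ (j ∷ w₂))
    Pj  = prefix j (starW σ (i ∷ w₁) w₂)
    Pd  = prefix (suc (i ℕ.+ j)) (starW σ w₁ w₂)
    Pd′ = prefix (i ℕ.+ j) (starW σ w₁ w₂)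

  L-concatMap : ∀ (g : 𝒞 × Word → 𝔥¹) a x n →
    (∀ c u → L W (g (c , u)) n ≋ a *ₛ (ev𝒞 c *ₛ W u n)) → L W (concatMap g x) n ≋ a *ₛ L W x n
  L-concatMap g a []            n hg = solve 1 (λ a → con 0ℚ := a :* con 0ℚ) ≋-refl a
  L-concatMap g a ((c , u) ∷ x) n hg = begin
    L W (g (c , u) ++ concatMap g x) n                ≈⟨ L-++ (g (c , u)) (concatMap g x) n ⟩
    L W (g (c , u)) n +ₛ L W (concatMap g x) n        ≈⟨ +-cong (hg c u) (L-concatMap g a x n hg) ⟩
    a *ₛ (ev𝒞 c *ₛ W u n) +ₛ a *ₛ L W x n
      ≈⟨ solve 3 (λ a b c → a :* b :+ a :* c := a :* (b :+ c)) ≋-refl a (ev𝒞 c *ₛ W u n) (L W x n) ⟩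
    a *ₛ L W ((c , u) ∷ x) n                          ∎
    where open ≋-Reasoning

  L-bilinear : ∀ σ n → (∀ u v → W u n *ₛ W v n ≋ L W (starW σ u v) n) →
    ∀ x y → L W x n *ₛ L W y n ≋ L W (star σ x y) n
  L-bilinear σ n words x y = ≋-sym (begin
    L W (star σ x y) n     ≈⟨ L-concatMap _ (L W y n) x n (λ c u → ≋-trans
                                (L-concatMap _ (ev𝒞 c *ₛ W u n) y n (term c u))
                                (solve 2 (λ a b → a :* b := b :* a) ≋-refl (ev𝒞 c *ₛ W u n) (L W y n))) ⟩
    L W y n *ₛ L W x n     ≈⟨ solve 2 (λ a b → a :* b := b :* a) ≋-refl (L W y n) (L W x n) ⟩
    L W x n *ₛ L W y n     ∎)
    where
    open ≋-Reasoning
    term : ∀ c u d v → L W (scale (c *𝒞 d) (starW σ u v)) n ≋ (ev𝒞 c *ₛ W u n) *ₛ (ev𝒞 d *ₛ W v n)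
    term c u d v = begin
      L W (scale (c *𝒞 d) (starW σ u v)) n      ≈⟨ L-scale (c *𝒞 d) (starW σ u v) n ⟩
      ev𝒞 (c *𝒞 d) *ₛ L W (starW σ u v) n       ≈⟨ *-cong (ev-* c d) (≋-sym (words u v)) ⟩
      (ev𝒞 c *ₛ ev𝒞 d) *ₛ (W u n *ₛ W v n)
        ≈⟨ solve 4 (λ a b x y → (a :* b) :* (x :* y) := (a :* x) :* (b :* y))
                   ≋-refl (ev𝒞 c) (ev𝒞 d) (W u n) (W v n) ⟩
      (ev𝒞 c *ₛ W u n) *ₛ (ev𝒞 d *ₛ W v n)      ∎

-- Iterated sums: a family W with W(z_k u)(0) = 0 and
--   W(z_k u)(n+1) = W(z_k u)(n) + F_k(n+1) W_u(d n),
-- where d n = n+1 gives non-strict and d n = n strict nested sums.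
module IteratedSum
  (W : Word → Seq) (F : ℕ → ℕ → Series) (d : ℕ → ℕ) (σ : ℚ)
  (W-empty : ∀ n → W [] n ≋ 1ₛ)
  (W-start : ∀ k u → W (k ∷ u) 0 ≋ 0ₛ)
  (W-step  : ∀ k u n → W (k ∷ u) (suc n) ≋ W (k ∷ u) n +ₛ F k (suc n) *ₛ W u (d n))
  (W-expand : ∀ i w₁ j w₂ n →
     W (i ∷ w₁) (suc n) *ₛ W (j ∷ w₂) (suc n) ≋
       W (i ∷ w₁) n *ₛ W (j ∷ w₂) n
       +ₛ F i (suc n) *ₛ (W w₁ (d n) *ₛ W (j ∷ w₂) (d n))
       +ₛ F j (suc n) *ₛ (W (i ∷ w₁) (d n) *ₛ W w₂ (d n))
       +ₛ (constₛ σ *ₛ (F i (suc n) *ₛ F j (suc n))) *ₛ (W w₁ (d n) *ₛ W w₂ (d n)))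
  (diagonal : ∀ i j m →
     constₛ σ *ₛ F (suc (i ℕ.+ j)) (suc m) +ₛ ħₛ *ₛ F (i ℕ.+ j) (suc m) ≋
       constₛ σ *ₛ (F i (suc m) *ₛ F j (suc m)))
  where

  open Linear W

  prefix-start : ∀ k x → L W (prefix k x) 0 ≋ 0ₛ
  prefix-start k []            = ≋-refl
  prefix-start k ((c , u) ∷ x) = begin
    ev𝒞 c *ₛ W (k ∷ u) 0 +ₛ L W (prefix k x) 0  ≈⟨ +-cong (*-congˡ (ev𝒞 c) (W-start k u)) (prefix-start k x) ⟩
    ev𝒞 c *ₛ 0ₛ +ₛ 0ₛ                           ≈⟨ solve 1 (λ a → a :* con 0ℚ :+ con 0ℚ := con 0ℚ) ≋-refl (ev𝒞 c) ⟩
    0ₛ                                          ∎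
    where open ≋-Reasoning

  prefix-step : ∀ k x n → L W (prefix k x) (suc n) ≋ L W (prefix k x) n +ₛ F k (suc n) *ₛ L W x (d n)
  prefix-step k []            n = solve 1 (λ f → con 0ℚ := con 0ℚ :+ f :* con 0ℚ) ≋-refl (F k (suc n))
  prefix-step k ((c , u) ∷ x) n = begin
    ev𝒞 c *ₛ W (k ∷ u) (suc n) +ₛ L W (prefix k x) (suc n)
      ≈⟨ +-cong (*-congˡ (ev𝒞 c) (W-step k u n)) (prefix-step k x n) ⟩
    ev𝒞 c *ₛ (W (k ∷ u) n +ₛ Fk *ₛ W u (d n)) +ₛ (L W (prefix k x) n +ₛ Fk *ₛ L W x (d n))
      ≈⟨ solve 6 (λ e a f b p l → e :* (a :+ f :* b) :+ (p :+ f :* l) := (e :* a :+ p) :+ f :* (e :* b :+ l))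
                 ≋-refl (ev𝒞 c) (W (k ∷ u) n) Fk (W u (d n)) (L W (prefix k x) n) (L W x (d n)) ⟩
    (ev𝒞 c *ₛ W (k ∷ u) n +ₛ L W (prefix k x) n) +ₛ Fk *ₛ (ev𝒞 c *ₛ W u (d n) +ₛ L W x (d n)) ∎
    where
    open ≋-Reasoning
    Fk = F k (suc n)

  star-start : ∀ i j w₁ w₂ → L W (starW σ (i ∷ w₁) (j ∷ w₂)) 0 ≋ 0ₛ
  star-start i j w₁ w₂ = begin
    L W (starW σ (i ∷ w₁) (j ∷ w₂)) 0           ≈⟨ L-starW σ i j w₁ w₂ 0 ⟩
    _ ≈⟨ +-cong (prefix-start i X) (+-cong (prefix-start j Y)
           (+-cong (*-congˡ (constₛ σ) (prefix-start (suc (i ℕ.+ j)) Z)) (*-congˡ ħₛ (prefix-start (i ℕ.+ j) Z)))) ⟩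
    0ₛ +ₛ (0ₛ +ₛ (constₛ σ *ₛ 0ₛ +ₛ ħₛ *ₛ 0ₛ))
      ≈⟨ solve 2 (λ c h → con 0ℚ :+ (con 0ℚ :+ (c :* con 0ℚ :+ h :* con 0ℚ)) := con 0ℚ) ≋-refl (constₛ σ) ħₛ ⟩
    0ₛ                                          ∎
    where
    open ≋-Reasoning
    X = starW σ w₁ (j ∷ w₂)
    Y = starW σ (i ∷ w₁) w₂
    Z = starW σ w₁ w₂

  star-step : ∀ i j w₁ w₂ n → L W (starW σ (i ∷ w₁) (j ∷ w₂)) (suc n) ≋
    L W (starW σ (i ∷ w₁) (j ∷ w₂)) n
    +ₛ F i (suc n) *ₛ L W (starW σ w₁ (j ∷ w₂)) (d n)
    +ₛ F j (suc n) *ₛ L W (starW σ (i ∷ w₁) w₂) (d n)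
    +ₛ (constₛ σ *ₛ F (suc (i ℕ.+ j)) (suc n) +ₛ ħₛ *ₛ F (i ℕ.+ j) (suc n)) *ₛ L W (starW σ w₁ w₂) (d n)
  star-step i j w₁ w₂ n = begin
    L W (starW σ (i ∷ w₁) (j ∷ w₂)) (suc n)
      ≈⟨ L-starW σ i j w₁ w₂ (suc n) ⟩
    _ ≈⟨ +-cong (prefix-step i X n) (+-cong (prefix-step j Y n)
           (+-cong (*-congˡ c (prefix-step (suc (i ℕ.+ j)) Z n)) (*-congˡ ħₛ (prefix-step (i ℕ.+ j) Z n)))) ⟩
    (Pi +ₛ Fi *ₛ LX) +ₛ ((Pj +ₛ Fj *ₛ LY) +ₛ (c *ₛ (Pd +ₛ Fd *ₛ LZ) +ₛ ħₛ *ₛ (Pd′ +ₛ Fd′ *ₛ LZ)))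
      ≈⟨ solve 13 (λ Pi Pj Pd Pd′ c h Fi Fj Fd Fd′ LX LY LZ →
           (Pi :+ Fi :* LX) :+ ((Pj :+ Fj :* LY) :+ (c :* (Pd :+ Fd :* LZ) :+ h :* (Pd′ :+ Fd′ :* LZ)))
           := (Pi :+ (Pj :+ (c :* Pd :+ h :* Pd′))) :+ Fi :* LX :+ Fj :* LY :+ (c :* Fd :+ h :* Fd′) :* LZ)
           ≋-refl Pi Pj Pd Pd′ c ħₛ Fi Fj Fd Fd′ LX LY LZ ⟩
    (Pi +ₛ (Pj +ₛ (c *ₛ Pd +ₛ ħₛ *ₛ Pd′))) +ₛ Fi *ₛ LX +ₛ Fj *ₛ LY +ₛ (c *ₛ Fd +ₛ ħₛ *ₛ Fd′) *ₛ LZ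
      ≈⟨ +-congʳ ((c *ₛ Fd +ₛ ħₛ *ₛ Fd′) *ₛ LZ) (+-congʳ (Fj *ₛ LY) (+-congʳ (Fi *ₛ LX)
           (≋-sym (L-starW σ i j w₁ w₂ n)))) ⟩
    L W (starW σ (i ∷ w₁) (j ∷ w₂)) n +ₛ Fi *ₛ LX +ₛ Fj *ₛ LY +ₛ (c *ₛ Fd +ₛ ħₛ *ₛ Fd′) *ₛ LZ ∎
    where
    open ≋-Reasoning
    X = starW σ w₁ (j ∷ w₂)
    Y = starW σ (i ∷ w₁) w₂
    Z = starW σ w₁ w₂
    c = constₛ σ
    Fi = F i (suc n)
    Fj = F j (suc n)
    Fd = F (suc (i ℕ.+ j)) (suc n)
    Fd′ = F (i ℕ.+ j) (suc n)
    Pi = L W (prefix i X) n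
    Pj = L W (prefix j Y) n
    Pd = L W (prefix (suc (i ℕ.+ j)) Z) n
    Pd′ = L W (prefix (i ℕ.+ j) Z) n
    LX = L W X (d n)
    LY = L W Y (d n)
    LZ = L W Z (d n)

  product-cons : ∀ i w₁ j w₂ →
    (∀ n → W w₁ n *ₛ W (j ∷ w₂) n ≋ L W (starW σ w₁ (j ∷ w₂)) n) →
    (∀ n → W (i ∷ w₁) n *ₛ W w₂ n ≋ L W (starW σ (i ∷ w₁) w₂) n) →
    (∀ n → W w₁ n *ₛ W w₂ n ≋ L W (starW σ w₁ w₂) n) →
    ∀ n → W (i ∷ w₁) n *ₛ W (j ∷ w₂) n ≋ L W (starW σ (i ∷ w₁) (j ∷ w₂)) n
  product-cons i w₁ j w₂ h₁ h₂ h₃ zero = begin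
    W (i ∷ w₁) 0 *ₛ W (j ∷ w₂) 0      ≈⟨ *-cong (W-start i w₁) (W-start j w₂) ⟩
    0ₛ *ₛ 0ₛ                          ≈⟨ solve 0 (con 0ℚ :* con 0ℚ := con 0ℚ) ≋-refl ⟩
    0ₛ                                ≈⟨ ≋-sym (star-start i j w₁ w₂) ⟩
    L W (starW σ (i ∷ w₁) (j ∷ w₂)) 0 ∎
    where open ≋-Reasoning
  product-cons i w₁ j w₂ h₁ h₂ h₃ (suc n) = begin
    W (i ∷ w₁) (suc n) *ₛ W (j ∷ w₂) (suc n)
      ≈⟨ W-expand i w₁ j w₂ n ⟩
    _ ≈⟨ +-cong (+-cong (+-cong (product-cons i w₁ j w₂ h₁ h₂ h₃ n)
                                (*-congˡ (F i (suc n)) (h₁ (d n))))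
                        (*-congˡ (F j (suc n)) (h₂ (d n))))
                (*-cong (≋-sym (diagonal i j n)) (h₃ (d n))) ⟩
    _ ≈⟨ ≋-sym (star-step i j w₁ w₂ n) ⟩
    L W (starW σ (i ∷ w₁) (j ∷ w₂)) (suc n) ∎
    where open ≋-Reasoning

  product : ∀ u v n → W u n *ₛ W v n ≋ L W (starW σ u v) n
  product []       v        n = begin
    W [] n *ₛ W v n   ≈⟨ *-congʳ (W v n) (W-empty n) ⟩
    1ₛ *ₛ W v n       ≈⟨ ⟨ *ₛ-identityˡ (W v n) ⟩ ⟩
    W v n             ≈⟨ ≋-sym (L-word v n) ⟩
    L W (word v) n    ∎
    where open ≋-Reasoning
  product (i ∷ w)  []       n = begin
    W (i ∷ w) n *ₛ W [] n   ≈⟨ *-congˡ (W (i ∷ w) n) (W-empty n) ⟩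
    W (i ∷ w) n *ₛ 1ₛ       ≈⟨ solve 1 (λ a → a :* con 1ℚ := a) ≋-refl (W (i ∷ w) n) ⟩
    W (i ∷ w) n             ≈⟨ ≋-sym (L-word (i ∷ w) n) ⟩
    L W (word (i ∷ w)) n    ∎
    where open ≋-Reasoning
  product (i ∷ w₁) (j ∷ w₂) n =
    product-cons i w₁ j w₂ (product w₁ (j ∷ w₂)) (product (i ∷ w₁) w₂) (product w₁ w₂) n

Σ₁-head : ∀ n F → Σ₁ (suc n) F ≡ F 1 +ₛ Σ₁ n (λ m → F (suc m))
Σ₁-head n F = P.trans (cong sumₛ (map-upTo (λ i → F (suc i)) (suc n)))
                      (cong (F 1 +ₛ_) (P.sym (cong sumₛ (map-upTo (λ i → F (suc (suc i))) n))))

Σ₁-last : ∀ n F → Σ₁ (suc n) F ≋ Σ₁ n F +ₛ F (suc n)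
Σ₁-last zero    F = ≋-trans (reflexive (Σ₁-head 0 F)) (solve 1 (λ a → a :+ con 0ℚ := con 0ℚ :+ a) ≋-refl (F 1))
Σ₁-last (suc n) F = begin
  Σ₁ (suc (suc n)) F                                  ≈⟨ reflexive (Σ₁-head (suc n) F) ⟩
  F 1 +ₛ Σ₁ (suc n) F′                                ≈⟨ +-congˡ (F 1) (Σ₁-last n F′) ⟩
  F 1 +ₛ (Σ₁ n F′ +ₛ F (suc (suc n)))
    ≈⟨ solve 3 (λ a b c → a :+ (b :+ c) := (a :+ b) :+ c) ≋-refl (F 1) (Σ₁ n F′) (F (suc (suc n))) ⟩
  (F 1 +ₛ Σ₁ n F′) +ₛ F (suc (suc n))                 ≈⟨ +-congʳ (F (suc (suc n))) (reflexive (P.sym (Σ₁-head n F))) ⟩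
  Σ₁ (suc n) F +ₛ F (suc (suc n))                     ∎
  where
  open ≋-Reasoning
  F′ : ℕ → Series
  F′ m = F (suc m)

summand : (ℕ → ℕ → Series) → ℕ → ℕ → Series
summand T k m = T k m *ₛ powₛ (Inv m) (suc k)

FS FA : ℕ → ℕ → Series
FS = summand (λ _ m → qpow m)
FA = summand (λ k m → qpow (k ℕ.* m))

SW-step : ∀ i u n → SW (i ∷ u) (suc n) ≋ SW (i ∷ u) n +ₛ FS i (suc n) *ₛ SW u (suc n)
SW-step i u n = Σ₁-last n (λ m → FS i m *ₛ SW u m)

AW-step : ∀ i u n → AW (i ∷ u) (suc n) ≋ AW (i ∷ u) n +ₛ FA i (suc n) *ₛ AW u n
AW-step i u n = Σ₁-last n (λ m → FA i m *ₛ AW u (m ℕ.∸ 1))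

-- A diagonal identity for summands reduces, since ħ/[m] = (1 - q^m)/[m]², to
-- the identity σ T_{a+b+1} + (1 - q^m) T_{a+b} = σ T_a T_b for the numerators.
summand-diagonal : ∀ σ T i j m →
  constₛ σ *ₛ T (suc (i ℕ.+ j)) (suc m) +ₛ (1ₛ +ₛ -ₛ qpow (suc m)) *ₛ T (i ℕ.+ j) (suc m) ≋
    constₛ σ *ₛ (T i (suc m) *ₛ T j (suc m)) →
  constₛ σ *ₛ summand T (suc (i ℕ.+ j)) (suc m) +ₛ ħₛ *ₛ summand T (i ℕ.+ j) (suc m) ≋
    constₛ σ *ₛ (summand T i (suc m) *ₛ summand T j (suc m))
summand-diagonal σ T i j m numerators = begin
  c *ₛ (T′ *ₛ (I *ₛ (I *ₛ X))) +ₛ ħₛ *ₛ (T₀ *ₛ (I *ₛ X))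
    ≈⟨ solve 7 (λ c h n I T′ T₀ X → c :* (T′ :* (I :* (I :* X))) :+ h :* (T₀ :* (I :* X))
          := c :* (T′ :* (I :* (I :* X))) :+ (h :* n) :* (T₀ :* (I :* (I :* X)))
             :+ (h :* (T₀ :* (I :* X))) :* (con 1ℚ :+ :- (n :* I)))
       ≋-refl c ħₛ (qint (suc m)) I T′ T₀ X ⟩
  c *ₛ (T′ *ₛ (I *ₛ (I *ₛ X))) +ₛ (ħₛ *ₛ qint (suc m)) *ₛ (T₀ *ₛ (I *ₛ (I *ₛ X)))
    +ₛ (ħₛ *ₛ (T₀ *ₛ (I *ₛ X))) *ₛ (1ₛ +ₛ -ₛ (qint (suc m) *ₛ I))
    ≈⟨ +-cong (+-congˡ (c *ₛ (T′ *ₛ (I *ₛ (I *ₛ X)))) (*-congʳ (T₀ *ₛ (I *ₛ (I *ₛ X))) (ħ-qint (suc m))))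
              (*-congˡ (ħₛ *ₛ (T₀ *ₛ (I *ₛ X))) (+-congˡ 1ₛ (-‿cong (qint-Inv m)))) ⟩
  c *ₛ (T′ *ₛ (I *ₛ (I *ₛ X))) +ₛ (1ₛ +ₛ -ₛ Q) *ₛ (T₀ *ₛ (I *ₛ (I *ₛ X)))
    +ₛ (ħₛ *ₛ (T₀ *ₛ (I *ₛ X))) *ₛ (1ₛ +ₛ -ₛ 1ₛ)
    ≈⟨ solve 7 (λ c h Q I T′ T₀ X → c :* (T′ :* (I :* (I :* X))) :+ (con 1ℚ :+ :- Q) :* (T₀ :* (I :* (I :* X)))
          :+ (h :* (T₀ :* (I :* X))) :* (con 1ℚ :+ :- con 1ℚ)
          := (c :* T′ :+ (con 1ℚ :+ :- Q) :* T₀) :* (I :* (I :* X)))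
       ≋-refl c ħₛ Q I T′ T₀ X ⟩
  (c *ₛ T′ +ₛ (1ₛ +ₛ -ₛ Q) *ₛ T₀) *ₛ (I *ₛ (I *ₛ X))
    ≈⟨ *-cong numerators (*-congˡ I (*-congˡ I (pow-+ I i j))) ⟩
  c *ₛ (Tᵢ *ₛ Tⱼ) *ₛ (I *ₛ (I *ₛ (powₛ I i *ₛ powₛ I j)))
    ≈⟨ solve 6 (λ c Tᵢ Tⱼ I a b → c :* (Tᵢ :* Tⱼ) :* (I :* (I :* (a :* b)))
          := c :* ((Tᵢ :* (I :* a)) :* (Tⱼ :* (I :* b))))
       ≋-refl c Tᵢ Tⱼ I (powₛ I i) (powₛ I j) ⟩
  c *ₛ ((Tᵢ *ₛ (I *ₛ powₛ I i)) *ₛ (Tⱼ *ₛ (I *ₛ powₛ I j))) ∎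
  where
  open ≋-Reasoning
  c = constₛ σ
  I = Inv (suc m)
  Q = qpow (suc m)
  X = powₛ I (i ℕ.+ j)
  T′ = T (suc (i ℕ.+ j)) (suc m)
  T₀ = T (i ℕ.+ j) (suc m)
  Tᵢ = T i (suc m)
  Tⱼ = T j (suc m)

FS-diagonal : ∀ i j m → constₛ (- 1ℚ) *ₛ FS (suc (i ℕ.+ j)) (suc m) +ₛ ħₛ *ₛ FS (i ℕ.+ j) (suc m) ≋
  constₛ (- 1ℚ) *ₛ (FS i (suc m) *ₛ FS j (suc m))
FS-diagonal i j m = summand-diagonal (- 1ℚ) (λ _ m → qpow m) i j m
  (solve 1 (λ Q → con (- 1ℚ) :* Q :+ (con 1ℚ :+ :- Q) :* Q := con (- 1ℚ) :* (Q :* Q)) ≋-refl (qpow (suc m)))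

FA-diagonal : ∀ i j m → constₛ 1ℚ *ₛ FA (suc (i ℕ.+ j)) (suc m) +ₛ ħₛ *ₛ FA (i ℕ.+ j) (suc m) ≋
  constₛ 1ℚ *ₛ (FA i (suc m) *ₛ FA j (suc m))
FA-diagonal i j m = summand-diagonal 1ℚ (λ k m → qpow (k ℕ.* m)) i j m (begin
  constₛ 1ℚ *ₛ qpow (M ℕ.+ (i ℕ.+ j) ℕ.* M) +ₛ (1ₛ +ₛ -ₛ Q) *ₛ T
    ≈⟨ +-congʳ ((1ₛ +ₛ -ₛ Q) *ₛ T) (*-congˡ (constₛ 1ℚ) (≋-sym ⟨ qpow-+ M ((i ℕ.+ j) ℕ.* M) ⟩)) ⟩
  constₛ 1ℚ *ₛ (Q *ₛ T) +ₛ (1ₛ +ₛ -ₛ Q) *ₛ T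
    ≈⟨ solve 2 (λ Q T → con 1ℚ :* (Q :* T) :+ (con 1ℚ :+ :- Q) :* T := con 1ℚ :* T) ≋-refl Q T ⟩
  constₛ 1ℚ *ₛ T
    ≈⟨ *-congˡ (constₛ 1ℚ) (≋-trans (reflexive (cong qpow (ℕP.*-distribʳ-+ M i j)))
                                    (≋-sym ⟨ qpow-+ (i ℕ.* M) (j ℕ.* M) ⟩)) ⟩
  constₛ 1ℚ *ₛ (qpow (i ℕ.* M) *ₛ qpow (j ℕ.* M)) ∎)
  where
  open ≋-Reasoning
  M = suc m
  Q = qpow M
  T = qpow ((i ℕ.+ j) ℕ.* M)

-- Expanding a product of two non-strict sums: the diagonal summand m₁ = m₁′
-- is counted in both one-sided terms, hence subtracted once.
SW-expand : ∀ i w₁ j w₂ n →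
  SW (i ∷ w₁) (suc n) *ₛ SW (j ∷ w₂) (suc n) ≋
    SW (i ∷ w₁) n *ₛ SW (j ∷ w₂) n
    +ₛ FS i (suc n) *ₛ (SW w₁ (suc n) *ₛ SW (j ∷ w₂) (suc n))
    +ₛ FS j (suc n) *ₛ (SW (i ∷ w₁) (suc n) *ₛ SW w₂ (suc n))
    +ₛ (constₛ (- 1ℚ) *ₛ (FS i (suc n) *ₛ FS j (suc n))) *ₛ (SW w₁ (suc n) *ₛ SW w₂ (suc n))
SW-expand i w₁ j w₂ n = begin
  SW (i ∷ w₁) (suc n) *ₛ SW (j ∷ w₂) (suc n)
    ≈⟨ *-cong (SW-step i w₁ n) (SW-step j w₂ n) ⟩
  (U +ₛ Fi *ₛ s₁) *ₛ (V +ₛ Fj *ₛ s₂)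
    ≈⟨ solve 6 (λ U V Fi Fj s₁ s₂ → (U :+ Fi :* s₁) :* (V :+ Fj :* s₂)
          := U :* V :+ Fi :* (s₁ :* (V :+ Fj :* s₂)) :+ Fj :* ((U :+ Fi :* s₁) :* s₂)
             :+ (con (- 1ℚ) :* (Fi :* Fj)) :* (s₁ :* s₂))
       ≋-refl U V Fi Fj s₁ s₂ ⟩
  U *ₛ V +ₛ Fi *ₛ (s₁ *ₛ (V +ₛ Fj *ₛ s₂)) +ₛ Fj *ₛ ((U +ₛ Fi *ₛ s₁) *ₛ s₂)
    +ₛ (constₛ (- 1ℚ) *ₛ (Fi *ₛ Fj)) *ₛ (s₁ *ₛ s₂)
    ≈⟨ +-congʳ ((constₛ (- 1ℚ) *ₛ (Fi *ₛ Fj)) *ₛ (s₁ *ₛ s₂))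
         (+-cong (+-congˡ (U *ₛ V) (*-congˡ Fi (*-congˡ s₁ (≋-sym (SW-step j w₂ n)))))
                 (*-congˡ Fj (*-congʳ s₂ (≋-sym (SW-step i w₁ n))))) ⟩
  U *ₛ V +ₛ Fi *ₛ (s₁ *ₛ SW (j ∷ w₂) (suc n)) +ₛ Fj *ₛ (SW (i ∷ w₁) (suc n) *ₛ s₂)
    +ₛ (constₛ (- 1ℚ) *ₛ (Fi *ₛ Fj)) *ₛ (s₁ *ₛ s₂) ∎
  where
  open ≋-Reasoning
  U = SW (i ∷ w₁) n
  V = SW (j ∷ w₂) n
  s₁ = SW w₁ (suc n)
  s₂ = SW w₂ (suc n)
  Fi = FS i (suc n)
  Fj = FS j (suc n)

AW-expand : ∀ i w₁ j w₂ n →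
  AW (i ∷ w₁) (suc n) *ₛ AW (j ∷ w₂) (suc n) ≋
    AW (i ∷ w₁) n *ₛ AW (j ∷ w₂) n
    +ₛ FA i (suc n) *ₛ (AW w₁ n *ₛ AW (j ∷ w₂) n)
    +ₛ FA j (suc n) *ₛ (AW (i ∷ w₁) n *ₛ AW w₂ n)
    +ₛ (constₛ 1ℚ *ₛ (FA i (suc n) *ₛ FA j (suc n))) *ₛ (AW w₁ n *ₛ AW w₂ n)
AW-expand i w₁ j w₂ n = ≋-trans (*-cong (AW-step i w₁ n) (AW-step j w₂ n))
  (solve 6 (λ U V Fi Fj s₁ s₂ → (U :+ Fi :* s₁) :* (V :+ Fj :* s₂)
      := U :* V :+ Fi :* (s₁ :* V) :+ Fj :* (U :* s₂) :+ (con 1ℚ :* (Fi :* Fj)) :* (s₁ :* s₂))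
   ≋-refl (AW (i ∷ w₁) n) (AW (j ∷ w₂) n) (FA i (suc n)) (FA j (suc n)) (AW w₁ n) (AW w₂ n))

module SumS = IteratedSum SW FS suc (- 1ℚ) (λ _ → ≋-refl) (λ _ _ → ≋-refl) SW-step SW-expand FS-diagonal
module SumA = IteratedSum AW FA (λ n → n) 1ℚ (λ _ → ≋-refl) (λ _ _ → ≋-refl) AW-step AW-expand FA-diagonal

product-via-L : ∀ (M : 𝔥¹ → Seq) W σ → (∀ x n → M x n ≡ L W x n) →
  (∀ u v n → W u n *ₛ W v n ≋ L W (starW σ u v) n) →
  ∀ x y → (M x · M y) ≈ᴺ M (star σ x y)
product-via-L M W σ M-is-L words x y n k = begin
  (M x n *ₛ M y n) k            ≡⟨ cong (λ f → f k) (cong₂ _*ₛ_ (M-is-L x n) (M-is-L y n)) ⟩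
  (L W x n *ₛ L W y n) k        ≡⟨ at (Linear.L-bilinear W σ n (λ u v → words u v n) x y) k ⟩
  L W (star σ x y) n k          ≡⟨ cong (λ f → f k) (P.sym (M-is-L (star σ x y) n)) ⟩
  M (star σ x y) n k            ∎
  where open P.≡-Reasoning

proposition2p3 : (w₁ w₂ : 𝔥¹) →
    ((S w₁ · S w₂) ≈ᴺ S (w₁ *₋ w₂)) × ((A w₁ · A w₂) ≈ᴺ A (w₁ *₊ w₂))
proposition2p3 w₁ w₂ =
  product-via-L S SW (- 1ℚ) S-is-L SumS.product w₁ w₂ ,
  product-via-L A AW 1ℚ A-is-L SumA.product w₁ w₂
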